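{- Let $G$ be a finite, simple, connected graph with diameter $d$, and let $v \in V(G)$ satisfy $\epsilon(v) = \lceil d/2 \rceil$. Then ${\rm d}(v) \geq 2$.
   Context: $\epsilon(v)=\max_{u\in V(G)} d(u,v)$ is the eccentricity of $v$, where $d(u,v)$ is the shortest-path distance; $d=\max_{u,v}d(u,v)$ is the diameter of $G$; ${\rm d}(v)$ is the degree of $v$. -}

module Defs where

open import Data.Nat using (ℕ; zero; suc; _≤_)
open import Data.Bool using (Bool; true; false; if_then_else_)
open import Data.Fin using (Fin)
open import Data.List using (map; allFin)
open import Data.Nat.ListAction using (sum)
open import Data.Product using (Σ; ∃; ∃-syntax; _×_)
open import Relation.Binary.PropositionalEquality using (_≡_)

record Graph (n : ℕ) : Set where
  field
    adj    : Fin n → Fin n → Bool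
    sym    : ∀ u v → adj u v ≡ adj v u
    irrefl : ∀ u → adj u u ≡ false
open Graph public

module _ {n : ℕ} (G : Graph n) where

  data Walk : Fin n → Fin n → ℕ → Set where
    nil  : ∀ {u} → Walk u u 0
    cons : ∀ {u w v k} → adj G u w ≡ true → Walk w v k → Walk u v (suc k)

  Connected : Set
  Connected = ∀ u v → ∃[ k ] Walk u v k

  Dist : Fin n → Fin n → ℕ → Set
  Dist u v k = Walk u v k × (∀ m → Walk u v m → k ≤ m)

  Ecc : Fin n → ℕ → Set
  Ecc v e = (∀ u k → Dist u v k → k ≤ e) × (∃[ u ] Dist u v e)

  Diam : ℕ → Set
  Diam D = (∀ u v k → Dist u v k → k ≤ D) × (∃[ u ] ∃[ v ] Dist u v D)

  degree : Fin n → ℕ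
  degree v = sum (map (λ u → if adj G v u then 1 else 0) (allFin n))

-- If d(v) ≤ 1, then v is a leaf with unique neighbour w (n ≥ 3 and connectivity
-- rule out isolated vertices), and every shortest path from v leaves through w.
-- So every vertex lies within ε(v) - 1 of w, whence d ≤ 2(ε(v) - 1) and
-- ⌈d/2⌉ < ε(v). The degenerate case ε(v) ≤ 1 is impossible: all vertices other
-- than v would then coincide with w, contradicting n ≥ 3.
module Submission where

open import Defs
open import Data.Nat using (ℕ; zero; suc; _+_; _∸_; _≤_; _<_; s≤s; _≤?_; ⌈_/2⌉)
open import Data.Fin using (Fin)
open import Data.Nat.Properties
  using (m≤m+n; m≤n+m; +-comm; +-monoʳ-≤; +-mono-≤; ≤-trans; ≤-refl; ≮⇒≥;
         m<1+n⇒m<n∨m≡n; ∸-monoˡ-≤; ⌈n/2⌉-mono; n≡⌈n+n/2⌉; <-irrefl)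
import Data.Fin as Fin
open import Data.Fin.Properties using (any?)
open import Data.Bool using (true; if_then_else_)
import Data.Bool as Bool
open import Data.List using (map; allFin; tabulate)
open import Data.List.Properties using (map-tabulate)
open import Data.Nat.ListAction using (sum)
open import Data.Product using (∃-syntax; _×_; _,_; proj₁; proj₂)
open import Data.Sum using (_⊎_; inj₁; inj₂)
open import Data.Empty using (⊥-elim)
open import Relation.Nullary using (¬_; Dec; yes; no; _×-dec_)
open import Relation.Nullary.Decidable using (decidable-stable)
open import Relation.Unary using (Pred; Decidable)
open import Relation.Binary.PropositionalEquality
  using (_≡_; _≢_; refl; trans; cong; cong₂; subst)
  renaming (sym to ≡-sym)
open import Function using (_∘_)

module _ {p} {P : Pred ℕ p} (P? : Decidable P) where

  Least : Set p
  Least = ∃[ m ] P m × (∀ j → P j → m ≤ j)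

  least-or-none-below : ∀ i → Least ⊎ (∀ j → j < i → ¬ P j)
  least-or-none-below zero = inj₂ λ _ ()
  least-or-none-below (suc i) with least-or-none-below i | P? i
  ... | inj₁ least | _     = inj₁ least
  ... | inj₂ none  | yes p = inj₁ (i , p , λ j pj → ≮⇒≥ λ j<i → none j j<i pj)
  ... | inj₂ none  | no ¬p = inj₂ λ j j<1+i → not-below (m<1+n⇒m<n∨m≡n j<1+i)
    where
      not-below : ∀ {j} → j < i ⊎ j ≡ i → ¬ P j
      not-below (inj₁ j<i)  = none _ j<i
      not-below (inj₂ refl) = ¬p

  least-witness : ∀ {k} → P k → Least
  least-witness {k} pk with least-or-none-below (suc k)
  ... | inj₁ least = least
  ... | inj₂ none  = ⊥-elim (none k ≤-refl pk)

sum-tabulate-≥ : ∀ {n} (f : Fin n → ℕ) a → f a ≤ sum (tabulate f)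
sum-tabulate-≥ f Fin.zero    = m≤m+n _ _
sum-tabulate-≥ f (Fin.suc a) = ≤-trans (sum-tabulate-≥ (f ∘ Fin.suc) a) (m≤n+m _ (f Fin.zero))

sum-tabulate-≥-pair : ∀ {n} (f : Fin n → ℕ) {a b} → a ≢ b → f a + f b ≤ sum (tabulate f)
sum-tabulate-≥-pair f {Fin.zero}  {Fin.zero}  a≢b = ⊥-elim (a≢b refl)
sum-tabulate-≥-pair f {Fin.zero}  {Fin.suc b} _   =
  +-monoʳ-≤ (f Fin.zero) (sum-tabulate-≥ (f ∘ Fin.suc) b)
sum-tabulate-≥-pair f {Fin.suc a} {Fin.zero}  _   =
  subst (_≤ sum (tabulate f)) (+-comm (f Fin.zero) (f (Fin.suc a)))
    (+-monoʳ-≤ (f Fin.zero) (sum-tabulate-≥ (f ∘ Fin.suc) a))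
sum-tabulate-≥-pair f {Fin.suc a} {Fin.suc b} a≢b =
  ≤-trans (sum-tabulate-≥-pair (f ∘ Fin.suc) (a≢b ∘ cong Fin.suc)) (m≤n+m _ (f Fin.zero))

two-others : ∀ {n} → 3 ≤ n → (v : Fin n) → ∃[ a ] ∃[ b ] a ≢ v × b ≢ v × a ≢ b
two-others (s≤s (s≤s (s≤s _))) Fin.zero =
  Fin.suc Fin.zero , Fin.suc (Fin.suc Fin.zero) , (λ ()) , (λ ()) , (λ ())
two-others (s≤s (s≤s (s≤s _))) (Fin.suc Fin.zero) =
  Fin.zero , Fin.suc (Fin.suc Fin.zero) , (λ ()) , (λ ()) , (λ ())
two-others (s≤s (s≤s (s≤s _))) (Fin.suc (Fin.suc _)) =
  Fin.zero , Fin.suc Fin.zero , (λ ()) , (λ ()) , (λ ())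

⌈n/2⌉≤m⇐n≤m+m : ∀ {n m} → n ≤ m + m → ⌈ n /2⌉ ≤ m
⌈n/2⌉≤m⇐n≤m+m {m = m} n≤m+m = subst (_ ≤_) (≡-sym (n≡⌈n+n/2⌉ m)) (⌈n/2⌉-mono n≤m+m)

module _ {n : ℕ} (G : Graph n) where

  adj-sym : ∀ {u v} → adj G u v ≡ true → adj G v u ≡ true
  adj-sym {u} {v} uv = trans (Graph.sym G v u) uv

  two-neighbours⇒2≤degree : ∀ {v a b} → adj G v a ≡ true → adj G v b ≡ true → a ≢ b →
                            2 ≤ degree G v
  two-neighbours⇒2≤degree {v} {a} {b} va vb a≢b =
    subst (2 ≤_) (cong sum (≡-sym (map-tabulate (λ u → u) indicator)))
      (subst (_≤ sum (tabulate indicator)) (cong₂ _+_ (counts va) (counts vb))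
        (sum-tabulate-≥-pair indicator a≢b))
    where
      indicator : Fin n → ℕ
      indicator u = if adj G v u then 1 else 0
      counts : ∀ {u} → adj G v u ≡ true → indicator u ≡ 1
      counts vu rewrite vu = refl

  _▷_ : ∀ {u w v k} → Walk G u w k → adj G w v ≡ true → Walk G u v (suc k)
  nil       ▷ wv = cons wv nil
  cons uw p ▷ wv = cons uw (p ▷ wv)

  reverse : ∀ {u v k} → Walk G u v k → Walk G v u k
  reverse nil        = nil
  reverse (cons uw p) = reverse p ▷ adj-sym uw

  _++_ : ∀ {u w v k m} → Walk G u w k → Walk G w v m → Walk G u v (k + m)
  nil       ++ q = q
  cons uw p ++ q = cons uw (p ++ q)

  walk? : ∀ k u v → Dec (Walk G u v k)
  walk? zero u v with u Fin.≟ v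
  ... | yes refl = yes nil
  ... | no u≢v   = no λ { nil → u≢v refl }
  walk? (suc k) u v with any? (λ w → (adj G u w Bool.≟ true) ×-dec walk? k w v)
  ... | yes (_ , uw , p) = yes (cons uw p)
  ... | no ∄step         = no λ { (cons uw p) → ∄step (_ , uw , p) }

  shortest-walk : Connected G → ∀ u v → ∃[ k ] Dist G u v k
  shortest-walk conn u v = least-witness (λ k → walk? k u v) (proj₂ (conn u v))

  walk⇒neighbour : ∀ {v z k} → z ≢ v → Walk G v z k → ∃[ w ] adj G v w ≡ true
  walk⇒neighbour z≢v nil         = ⊥-elim (z≢v refl)
  walk⇒neighbour _   (cons vw _) = _ , vw

  Ball : Fin n → ℕ → Fin n → Set
  Ball w r z = ∃[ k ] k ≤ r × Walk G w z k

  Ball-0 : ∀ {w z} → Ball w 0 z → w ≡ z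
  Ball-0 (zero , _ , nil) = refl

  Ball-mono : ∀ {w r s z} → r ≤ s → Ball w r z → Ball w s z
  Ball-mono r≤s (k , k≤r , p) = k , ≤-trans k≤r r≤s , p

  Ecc⇒Ball : Connected G → ∀ {v e} → Ecc G v e → ∀ z → Ball v e z
  Ecc⇒Ball conn {v} (ecc≤ , _) z =
    let k , zv = shortest-walk conn z v in k , ecc≤ z k zv , reverse (proj₁ zv)

  diameter≤2*radius : ∀ {w r d} → (∀ z → Ball w r z) → Diam G d → d ≤ r + r
  diameter≤2*radius inBall (_ , x , y , _ , shortest)
    with inBall x | inBall y
  ... | kx , kx≤r , wx | ky , ky≤r , wy =
    ≤-trans (shortest _ (reverse wx ++ wy)) (+-mono-≤ kx≤r ky≤r)

  degree<2⇒same-neighbour : ∀ {v a b} → ¬ 2 ≤ degree G v →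
                            adj G v a ≡ true → adj G v b ≡ true → a ≡ b
  degree<2⇒same-neighbour {a = a} {b} degree≱2 va vb with a Fin.≟ b
  ... | yes a≡b = a≡b
  ... | no a≢b  = ⊥-elim (degree≱2 (two-neighbours⇒2≤degree va vb a≢b))

  module Leaf {v w : Fin n} (vw : adj G v w ≡ true) (only-w : ∀ u → adj G v u ≡ true → u ≡ w) where

    walk-through-w : ∀ {z k} → z ≢ v → Walk G v z k → Walk G w z (k ∸ 1)
    walk-through-w z≢v nil = ⊥-elim (z≢v refl)
    walk-through-w _   (cons {w = u} vu p) with only-w u vu
    ... | refl = p

    Ball-through-w : ∀ {e z} → z ≢ v → Ball v e z → Ball w (e ∸ 1) z
    Ball-through-w z≢v (k , k≤e , p) = k ∸ 1 , ∸-monoˡ-≤ 1 k≤e , walk-through-w z≢v p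

    module _ (conn : Connected G) {e} (ecc : Ecc G v e) where

      2≤ecc : 3 ≤ n → 2 ≤ e
      2≤ecc 3≤n with two-others 3≤n v
      ... | a , b , a≢v , b≢v , a≢b = ≮⇒≥ λ e<2 →
        a≢b (trans (≡-sym (collapses a≢v e<2)) (collapses b≢v e<2))
        where
          collapses : ∀ {z} → z ≢ v → e < 2 → w ≡ z
          collapses z≢v (s≤s e≤1) =
            Ball-0 (Ball-mono (∸-monoˡ-≤ 1 e≤1) (Ball-through-w z≢v (Ecc⇒Ball conn ecc _)))

      ⌈diam/2⌉<ecc : ∀ {d} → Diam G d → 2 ≤ e → ⌈ d /2⌉ < e
      ⌈diam/2⌉<ecc diam 2≤e@(s≤s (s≤s _)) =
        s≤s (⌈n/2⌉≤m⇐n≤m+m (diameter≤2*radius inBall diam))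
        where
          inBall : ∀ z → Ball w (e ∸ 1) z
          inBall z with z Fin.≟ v
          ... | yes refl = 1 , ∸-monoˡ-≤ 1 2≤e , cons (adj-sym vw) nil
          ... | no z≢v   = Ball-through-w z≢v (Ecc⇒Ball conn ecc z)

lemma2 : ∀ (n : ℕ) (G : Graph n) → 3 ≤ n → Connected G →
           ∀ (d : ℕ) → Diam G d →
           ∀ (v : Fin n) → Ecc G v ⌈ d /2⌉ → 2 ≤ degree G v
lemma2 n G 3≤n conn d diam v ecc =
  decidable-stable (2 ≤? degree G v) λ degree≱2 →
    let a , _ , a≢v , _ = two-others 3≤n v
        w , vw = walk⇒neighbour G a≢v (proj₂ (conn v a))
        open Leaf G vw (λ u vu → degree<2⇒same-neighbour G degree≱2 vu vw)
    in <-irrefl refl (⌈diam/2⌉<ecc conn ecc diam (2≤ecc conn ecc 3≤n))
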